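{- If $w\in\{0,1\}^{\omega}$ and $n\ge1$, then \[ \tfrac1n d_n(w)\le d_n(\Sigma(w))\le n\,d_n(w). \]
   Context: $\{0,1\}^{\omega}$ is the set of infinite binary words $w=w_1w_2\cdots$, $w[k]=w_1\cdots w_k$, and $\Sigma(w)=w_2w_3\cdots$. For $\pi\in\mathfrak{S}_n$, $\mathrm{Des}(\pi)=x_1\cdots x_{n-1}$ with $x_i=1$ iff $\pi_i>\pi_{i+1}$, and $d_n(w)$ is the number of $\pi\in\mathfrak{S}_n$ with $\mathrm{Des}(\pi)=w[n-1]$. -}

module Defs where

open import Data.Bool using (Bool; true; false)
open import Data.Nat using (ℕ; suc; _<_; _>_)
open import Data.Nat.Properties using (n<1+n; <-trans)
open import Data.Fin using (Fin; toℕ; fromℕ<)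
open import Data.Vec using (Vec; lookup)
open import Data.Product using (_×_)
open import Data.Refinement using (Refinement)
open import Function.Definitions using (Injective)
open import Relation.Binary.PropositionalEquality using (_≡_)
open import Function.Bundles using (_⇔_)

-- Infinite binary words w = w₁ w₂ ⋯ , encoded 0-indexed: (w i) = w_{i+1},
-- with true = 1 and false = 0.
Word : Set
Word = ℕ → Bool

shift : Word → Word
shift w i = w (suc i)

IsPerm : (n : ℕ) → Vec (Fin n) n → Set
IsPerm n π = Injective _≡_ _≡_ (lookup π)

-- Des(π) = w[n-1]: for every position i (0-indexed, i+1 < n),
-- π_{i+1} > π_{i+2}  iff  w_{i+1} = 1.
HasDes : (n : ℕ) → Word → Vec (Fin n) n → Set
HasDes n w π =
  ∀ (i : ℕ) (h : suc i < n) →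
    (toℕ (lookup π (fromℕ< (<-trans (n<1+n i) h))) > toℕ (lookup π (fromℕ< h)))
      ⇔ (w i ≡ true)

-- The set { π ∈ 𝔖ₙ | Des(π) = w[n-1] } (proof-irrelevant subtype of vectors,
-- so that equality of elements is equality of one-line notations).
DesClass : (n : ℕ) → Word → Set
DesClass n w = Refinement (Vec (Fin n) n) (λ π → IsPerm n π × HasDes n w π)

{-# OPTIONS --safe #-}

-- Deleting the first entry π₁ of π and standardizing the rest leaves a
-- permutation of size n - 1 with descent word w₂ ⋯ w_{n-1}; appending a new
-- last entry, the minimum if w_n = 1 and the maximum otherwise, yields a
-- permutation with descent word Σ(w)[n-1].  As π is recovered from π₁ and the
-- result, this injects the descent class of w into [n] × (class of Σ(w)), so
-- d_n(w) ≤ n d_n(Σ(w)).  Dually, deleting the last entry and prepending a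
-- maximum or minimum according to w₁ gives d_n(Σ(w)) ≤ n d_n(w).
module Submission where

open import Defs
open import Data.Nat using (ℕ; _≤_; _*_)
open import Data.Fin using (Fin)
open import Data.Product using (_×_)
open import Function.Bundles using (_↔_)

open import Data.Bool using (Bool; true; false; not)
open import Data.Empty using (⊥-elim-irr)
open import Data.Fin
  using (zero; suc; toℕ; fromℕ; fromℕ<; inject₁; punchIn; punchOut; _<_; _≟_)
open import Data.Fin.Properties
  using ( toℕ-injective; toℕ<n; toℕ-fromℕ<; toℕ-inject₁; fromℕ<-toℕ; ≤fromℕ; ≤∧≢⇒<
        ; punchIn-injective; punchInᵢ≢i; punchIn-mono-≤; punchIn-cancel-≤
        ; punchOut-injective; punchOut-cong; punchIn-punchOut; punchOut-punchIn
        ; injective⇒≤; *↔×)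
open import Data.Nat as ℕ using (zero; suc)
open import Data.Nat.Properties using (<⇒≱; ≰⇒>)
open import Data.Product using (_,_; proj₁; proj₂)
open import Data.Product.Function.NonDependent.Propositional using (_×-↣_)
open import Data.Refinement using (_,_; value)
open import Data.Refinement.Properties using (value-injective)
open import Data.Irrelevant using ([_])
open import Data.Vec using (Vec; lookup; tabulate)
open import Data.Vec.Properties using (lookup∘tabulate; tabulate∘lookup; tabulate-cong)
open import Function using (_∘_; id)
open import Function.Bundles using (_⇔_; mk⇔; _↣_; mk↣; Equivalence; Injection)
open import Function.Construct.Composition using (_↣-∘_; _⇔-∘_)
open import Function.Construct.Identity using (↣-id)
open import Function.Construct.Symmetry using (⇔-sym; ↔-sym)
open import Function.Definitions using (Injective)
open import Function.Properties.Inverse using (↔⇒↣)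
open import Relation.Binary.PropositionalEquality
  using (_≡_; _≗_; refl; sym; trans; cong; cong₂; subst₂; module ≡-Reasoning)
open import Relation.Nullary using (yes; no; contradiction)

↣-×⇒≤-* : ∀ {A B : Set} {a b n : ℕ} →
  Fin a ↔ A → Fin b ↔ B → A ↣ (Fin n × B) → a ≤ n * b
↣-×⇒≤-* A↔ B↔ A↣ = injective⇒≤ (Injection.injective
  (↔⇒↣ (↔-sym *↔×) ↣-∘ ((↣-id _ ×-↣ ↔⇒↣ (↔-sym B↔)) ↣-∘ (A↣ ↣-∘ ↔⇒↣ A↔))))

tabulate-injective : ∀ {A : Set} {n} {f g : Fin n → A} → tabulate f ≡ tabulate g → f ≗ g
tabulate-injective {f = f} {g} e i =
  trans (sym (lookup∘tabulate f i)) (trans (cong (λ xs → lookup xs i) e) (lookup∘tabulate g i))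

lookup-≗⇒≡ : ∀ {A : Set} {n} {xs ys : Vec A n} → lookup xs ≗ lookup ys → xs ≡ ys
lookup-≗⇒≡ {xs = xs} {ys} e =
  trans (sym (tabulate∘lookup xs)) (trans (tabulate-cong e) (tabulate∘lookup ys))

punchIn-fromℕ : ∀ {m} (j : Fin m) → punchIn (fromℕ m) j ≡ inject₁ j
punchIn-fromℕ zero    = refl
punchIn-fromℕ (suc j) = cong suc (punchIn-fromℕ j)

punchIn-<⇔ : ∀ {m} (v : Fin (suc m)) (x y : Fin m) → punchIn v x < punchIn v y ⇔ x < y
punchIn-<⇔ v x y = mk⇔
  (λ lt → ≰⇒> (λ y≤x → <⇒≱ lt (punchIn-mono-≤ v y x y≤x)))
  (λ lt → ≰⇒> (λ le → <⇒≱ lt (punchIn-cancel-≤ v y x le)))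

SameOrder : ∀ {k m n} → (Fin k → Fin m) → (Fin k → Fin n) → Set
SameOrder f g = ∀ i j → f i < f j ⇔ g i < g j

SameOrder-sym : ∀ {k m n} {f : Fin k → Fin m} {g : Fin k → Fin n} →
  SameOrder f g → SameOrder g f
SameOrder-sym S i j = ⇔-sym (S i j)

SameOrder-trans : ∀ {k m n o} {f : Fin k → Fin m} {g : Fin k → Fin n} {h : Fin k → Fin o} →
  SameOrder f g → SameOrder g h → SameOrder f h
SameOrder-trans S T i j = T i j ⇔-∘ S i j

≗⇒SameOrder : ∀ {k m} {f g : Fin k → Fin m} → f ≗ g → SameOrder f g
≗⇒SameOrder {f = f} e i j = subst₂ (λ x y → f i < f j ⇔ x < y) (e i) (e j) (mk⇔ id id)

punchIn-SameOrder : ∀ {k m} (v : Fin (suc m)) (σ : Fin k → Fin m) → SameOrder (punchIn v ∘ σ) σ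
punchIn-SameOrder v σ i j = punchIn-<⇔ v (σ i) (σ j)

-- The injectivity proof is irrelevant so that removeAt applies to the
-- irrelevant proofs carried by DesClass.
removeAt : ∀ {m n} (f : Fin (suc m) → Fin (suc n)) → .(Injective _≡_ _≡_ f) →
  Fin (suc m) → Fin m → Fin n
removeAt f f-inj p j =
  punchOut {i = f p} {j = f (punchIn p j)} (λ e → ⊥-elim-irr (punchInᵢ≢i p j (sym (f-inj e))))

module _ {m n} (f : Fin (suc m) → Fin (suc n)) .(f-inj : Injective _≡_ _≡_ f)
         (p : Fin (suc m)) where

  punchIn-removeAt : ∀ j → punchIn (f p) (removeAt f f-inj p j) ≡ f (punchIn p j)
  punchIn-removeAt j = punchIn-punchOut _

  removeAt-SameOrder : SameOrder (removeAt f f-inj p) (f ∘ punchIn p)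
  removeAt-SameOrder = SameOrder-trans
    (SameOrder-sym (punchIn-SameOrder (f p) (removeAt f f-inj p)))
    (≗⇒SameOrder punchIn-removeAt)

removeAt-injective : ∀ {m n} {f : Fin (suc m) → Fin (suc n)} (f-inj : Injective _≡_ _≡_ f) p →
  Injective _≡_ _≡_ (removeAt f f-inj p)
removeAt-injective {f = f} f-inj p {j} {k} e =
  punchIn-injective p j k (f-inj (punchOut-injective {i = f p} _ _ e))

≗-from-removeAt : ∀ {m n} {f g : Fin (suc m) → Fin (suc n)}
  .{f-inj : Injective _≡_ _≡_ f} .{g-inj : Injective _≡_ _≡_ g} p →
  f p ≡ g p → removeAt f f-inj p ≗ removeAt g g-inj p → f ≗ g
≗-from-removeAt {f = f} {g} {f-inj} {g-inj} p fp≡gp e k with p ≟ k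
... | yes refl = fp≡gp
... | no p≢k = begin
  f k                                       ≡⟨ cong f (sym (punchIn-punchOut p≢k)) ⟩
  f (punchIn p j)                           ≡⟨ sym (punchIn-removeAt f f-inj p j) ⟩
  punchIn (f p) (removeAt f f-inj p j)      ≡⟨ cong₂ punchIn fp≡gp (e j) ⟩
  punchIn (g p) (removeAt g g-inj p j)      ≡⟨ punchIn-removeAt g g-inj p j ⟩
  g (punchIn p j)                           ≡⟨ cong g (punchIn-punchOut p≢k) ⟩
  g k                                       ∎
  where
  open ≡-Reasoning
  j = punchOut p≢k

insertAt : ∀ {m n} → Fin (suc m) → Fin (suc n) → (Fin m → Fin n) → Fin (suc m) → Fin (suc n)
insertAt q v σ k with q ≟ k
... | yes _   = v
... | no q≢k = punchIn v (σ (punchOut q≢k))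

module _ {m n} (q : Fin (suc m)) (v : Fin (suc n)) where

  insertAt-here : ∀ σ → insertAt q v σ q ≡ v
  insertAt-here σ with q ≟ q
  ... | yes _   = refl
  ... | no q≢q = contradiction refl q≢q

  insertAt-punchIn : ∀ σ j → insertAt q v σ (punchIn q j) ≡ punchIn v (σ j)
  insertAt-punchIn σ j with q ≟ punchIn q j
  ... | yes q≡q↑j = contradiction (sym q≡q↑j) (punchInᵢ≢i q j)
  ... | no q≢q↑j = cong (punchIn v ∘ σ) (trans (punchOut-cong q refl) (punchOut-punchIn q))

  insertAt-SameOrder : ∀ σ → SameOrder (insertAt q v σ ∘ punchIn q) σ
  insertAt-SameOrder σ = SameOrder-trans (≗⇒SameOrder (insertAt-punchIn σ)) (punchIn-SameOrder v σ)

  insertAt-injective : ∀ {σ} → Injective _≡_ _≡_ σ → Injective _≡_ _≡_ (insertAt q v σ)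
  insertAt-injective {σ} σ-inj {k} {l} e with q ≟ k | q ≟ l
  ... | yes refl | yes refl = refl
  ... | yes refl | no q≢l  = contradiction (sym e) (punchInᵢ≢i v _)
  ... | no q≢k  | yes refl = contradiction e (punchInᵢ≢i v _)
  ... | no q≢k  | no q≢l  = punchOut-injective q≢k q≢l (σ-inj (punchIn-injective v _ _ e))

  insertAt-cancel : ∀ {σ τ} → insertAt q v σ ≗ insertAt q v τ → σ ≗ τ
  insertAt-cancel {σ} {τ} e j = punchIn-injective v (σ j) (τ j) (begin
    punchIn v (σ j)               ≡⟨ sym (insertAt-punchIn σ j) ⟩
    insertAt q v σ (punchIn q j)  ≡⟨ e (punchIn q j) ⟩
    insertAt q v τ (punchIn q j)  ≡⟨ insertAt-punchIn τ j ⟩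
    punchIn v (τ j)               ∎)
    where open ≡-Reasoning

moveEntry : ∀ {m} (p q v : Fin (suc m)) (f : Fin (suc m) → Fin (suc m)) →
  .(Injective _≡_ _≡_ f) → Fin (suc m) → Fin (suc m)
moveEntry p q v f f-inj = insertAt q v (removeAt f f-inj p)

module _ {m} (p q v : Fin (suc m)) where

  moveEntry-SameOrder : ∀ f .(f-inj : Injective _≡_ _≡_ f) →
    SameOrder (f ∘ punchIn p) (moveEntry p q v f f-inj ∘ punchIn q)
  moveEntry-SameOrder f f-inj = SameOrder-trans
    (SameOrder-sym (removeAt-SameOrder f f-inj p))
    (SameOrder-sym (insertAt-SameOrder q v (removeAt f f-inj p)))

  moveEntry-injective : ∀ {f} (f-inj : Injective _≡_ _≡_ f) →
    Injective _≡_ _≡_ (moveEntry p q v f f-inj)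
  moveEntry-injective f-inj = insertAt-injective q v (removeAt-injective f-inj p)

  ≗-from-moveEntry : ∀ {f g} .{f-inj : Injective _≡_ _≡_ f} .{g-inj : Injective _≡_ _≡_ g} →
    f p ≡ g p → moveEntry p q v f f-inj ≗ moveEntry p q v g g-inj → f ≗ g
  ≗-from-moveEntry {f-inj = f-inj} {g-inj} fp≡gp e =
    ≗-from-removeAt {f-inj = f-inj} {g-inj} p fp≡gp (insertAt-cancel q v e)

Descents : ∀ {n} (m : ℕ) → Word → (Fin (suc m) → Fin n) → Set
Descents m w f = ∀ (i : Fin m) → f (suc i) < f (inject₁ i) ⇔ w (toℕ i) ≡ true

Descents-resp : ∀ {m n n′ w} {f : Fin (suc m) → Fin n} {g : Fin (suc m) → Fin n′} →
  SameOrder f g → Descents m w f → Descents m w g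
Descents-resp S D i = D i ⇔-∘ ⇔-sym (S (suc i) (inject₁ i))

Descents-cons : ∀ {m n w} (f : Fin (suc (suc m)) → Fin n) →
  (f (suc zero) < f zero ⇔ w 0 ≡ true) → Descents m (shift w) (f ∘ suc) → Descents (suc m) w f
Descents-cons f first D zero    = first
Descents-cons f first D (suc i) = D i

Descents-snoc : ∀ {m n w} (f : Fin (suc (suc m)) → Fin n) →
  Descents m w (f ∘ inject₁) → (f (fromℕ (suc m)) < f (inject₁ (fromℕ m)) ⇔ w m ≡ true) →
  Descents (suc m) w f
Descents-snoc {zero}  f D last zero    = last
Descents-snoc {suc m} f D last zero    = D zero
Descents-snoc {suc m} {w = w} f D last (suc i) =
  Descents-snoc {w = shift w} (f ∘ suc) (λ j → D (suc j)) last i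

Descents-init : ∀ {m n w} {f : Fin (suc (suc m)) → Fin n} →
  Descents (suc m) w f → Descents m w (f ∘ inject₁)
Descents-init {suc m} D zero    = D zero
Descents-init {suc m} {w = w} {f} D (suc i) =
  Descents-init {w = shift w} {f ∘ suc} (λ j → D (suc j)) i

minIf : ∀ {m} → Bool → Fin (suc m)
minIf     true  = zero
minIf {m} false = fromℕ m

maxIf : ∀ {m} → Bool → Fin (suc m)
maxIf b = minIf (not b)

minIf-<-punchIn : ∀ {m} b (j : Fin m) → minIf {m} b < punchIn (minIf b) j ⇔ b ≡ true
minIf-<-punchIn     true  j = mk⇔ (λ _ → refl) (λ _ → ℕ.z<s)
minIf-<-punchIn {m} false j =
  mk⇔ (λ lt → contradiction (≤fromℕ (punchIn (fromℕ m) j)) (<⇒≱ lt)) (λ ())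

punchIn-<-maxIf : ∀ {m} b (j : Fin m) → punchIn (maxIf b) j < maxIf {m} b ⇔ b ≡ true
punchIn-<-maxIf {m} true  j = mk⇔ (λ _ → refl) (λ _ → ≤∧≢⇒< (≤fromℕ _) (punchInᵢ≢i (fromℕ m) j))
punchIn-<-maxIf     false j = mk⇔ (λ ()) (λ ())

descents-moveFirstToLast : ∀ {m w} f .(f-inj : Injective _≡_ _≡_ f) → Descents m w f →
  Descents m (shift w) (moveEntry zero (fromℕ m) (minIf (w m)) f f-inj)
descents-moveFirstToLast {zero}      f f-inj D ()
descents-moveFirstToLast {suc m} {w} f f-inj D =
  Descents-snoc {w = shift w} τ (Descents-resp {w = shift w} interior (λ i → D (suc i))) last
  where
  v : Fin (suc (suc m))
  v = minIf (w (suc m))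
  σ : Fin (suc m) → Fin (suc m)
  σ = removeAt f f-inj zero
  τ : Fin (suc (suc m)) → Fin (suc (suc m))
  τ = moveEntry zero (fromℕ (suc m)) v f f-inj

  interior : SameOrder (f ∘ suc) (τ ∘ inject₁)
  interior = SameOrder-trans (moveEntry-SameOrder zero (fromℕ (suc m)) v f f-inj)
                             (≗⇒SameOrder (cong τ ∘ punchIn-fromℕ))

  last : τ (fromℕ (suc m)) < τ (inject₁ (fromℕ m)) ⇔ w (suc m) ≡ true
  last = subst₂ (λ x y → x < y ⇔ w (suc m) ≡ true)
    (sym (insertAt-here (fromℕ (suc m)) v σ))
    (trans (sym (insertAt-punchIn (fromℕ (suc m)) v σ (fromℕ m)))
           (cong τ (punchIn-fromℕ (fromℕ m))))
    (minIf-<-punchIn (w (suc m)) (σ (fromℕ m)))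

descents-moveLastToFirst : ∀ {m w} f .(f-inj : Injective _≡_ _≡_ f) → Descents m (shift w) f →
  Descents m w (moveEntry (fromℕ m) zero (maxIf (w 0)) f f-inj)
descents-moveLastToFirst {zero}      f f-inj D ()
descents-moveLastToFirst {suc m} {w} f f-inj D =
  Descents-cons {w = w} τ first
    (Descents-resp {w = shift w} interior (Descents-init {w = shift w} {f} D))
  where
  v : Fin (suc (suc m))
  v = maxIf (w 0)
  σ : Fin (suc m) → Fin (suc m)
  σ = removeAt f f-inj (fromℕ (suc m))
  τ : Fin (suc (suc m)) → Fin (suc (suc m))
  τ = moveEntry (fromℕ (suc m)) zero v f f-inj

  interior : SameOrder (f ∘ inject₁) (τ ∘ suc)
  interior = SameOrder-trans (≗⇒SameOrder (cong f ∘ sym ∘ punchIn-fromℕ))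
                             (moveEntry-SameOrder (fromℕ (suc m)) zero v f f-inj)

  first : τ (suc zero) < τ zero ⇔ w 0 ≡ true
  first = subst₂ (λ x y → x < y ⇔ w 0 ≡ true)
    (sym (insertAt-punchIn zero v σ zero))
    (sym (insertAt-here zero v σ))
    (punchIn-<-maxIf (w 0) (σ zero))

HasDes⇔Descents : ∀ {m} w (π : Vec (Fin (suc m)) (suc m)) →
  HasDes (suc m) w π ⇔ Descents m w (lookup π)
HasDes⇔Descents {m} w π = mk⇔ to from
  where
  descent-cong : ∀ {x x′ y y′ i i′} → x ≡ x′ → y ≡ y′ → i ≡ i′ →
    lookup π y < lookup π x ⇔ w i ≡ true → lookup π y′ < lookup π x′ ⇔ w i′ ≡ true
  descent-cong refl refl refl d = d

  to : HasDes (suc m) w π → Descents m w (lookup π)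
  to H k = descent-cong
    (toℕ-injective (trans (toℕ-fromℕ< _) (sym (toℕ-inject₁ k))))
    (fromℕ<-toℕ (suc k) (toℕ<n (suc k)))
    refl
    (H (toℕ k) (toℕ<n (suc k)))

  from : Descents m w (lookup π) → HasDes (suc m) w π
  from D i h = descent-cong
    (toℕ-injective (trans (toℕ-inject₁ k) (trans k≡i (sym (toℕ-fromℕ< _)))))
    (toℕ-injective (trans (cong suc k≡i) (sym (toℕ-fromℕ< h))))
    k≡i
    (D k)
    where
    k = fromℕ< (ℕ.s<s⁻¹ h)
    k≡i : toℕ k ≡ i
    k≡i = toℕ-fromℕ< _

IsPerm-tabulate : ∀ {n} {f : Fin n → Fin n} → Injective _≡_ _≡_ f → IsPerm n (tabulate f)
IsPerm-tabulate {f = f} f-inj {i} {j} e =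
  f-inj (trans (sym (lookup∘tabulate f i)) (trans e (lookup∘tabulate f j)))

HasDes-tabulate : ∀ {m w} {f : Fin (suc m) → Fin (suc m)} →
  Descents m w f → HasDes (suc m) w (tabulate f)
HasDes-tabulate {w = w} {f} D = Equivalence.from (HasDes⇔Descents w (tabulate f))
  (Descents-resp {w = w} (≗⇒SameOrder (sym ∘ lookup∘tabulate f)) D)

moveEntry↣ : ∀ {m w w′} (p q v : Fin (suc m)) →
  (∀ f .(f-inj : Injective _≡_ _≡_ f) → Descents m w f → Descents m w′ (moveEntry p q v f f-inj)) →
  DesClass (suc m) w ↣ (Fin (suc m) × DesClass (suc m) w′)
moveEntry↣ {m} {w} {w′} p q v descents-moveEntry = mk↣ {to = to} to-injective
  where
  moved : (π : Vec (Fin (suc m)) (suc m)) → .(IsPerm (suc m) π) → Vec (Fin (suc m)) (suc m)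
  moved π π-perm = tabulate (moveEntry p q v (lookup π) π-perm)

  moved-ok : ∀ π (π-ok : IsPerm (suc m) π × HasDes (suc m) w π) →
    IsPerm (suc m) (moved π (proj₁ π-ok)) × HasDes (suc m) w′ (moved π (proj₁ π-ok))
  moved-ok π (π-perm , π-des) =
    IsPerm-tabulate (moveEntry-injective p q v π-perm) ,
    HasDes-tabulate {f = moveEntry p q v (lookup π) π-perm}
      (descents-moveEntry (lookup π) π-perm (Equivalence.to (HasDes⇔Descents w π) π-des))

  to : DesClass (suc m) w → Fin (suc m) × DesClass (suc m) w′
  to (π , [ π-ok ]) = lookup π p , (moved π (proj₁ π-ok) , [ moved-ok π π-ok ])

  to-injective : Injective _≡_ _≡_ to
  to-injective {π , [ π-ok ]} {π′ , [ π′-ok ]} e = value-injective (lookup-≗⇒≡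
    (≗-from-moveEntry p q v {f-inj = proj₁ π-ok} {proj₁ π′-ok}
      (cong proj₁ e) (tabulate-injective (cong (value ∘ proj₂) e))))

lemma3p6 : (w : Word) (n : ℕ) → 1 ≤ n →
    (a b : ℕ) → Fin a ↔ DesClass n w → Fin b ↔ DesClass n (shift w) →
    (a ≤ n * b) × (b ≤ n * a)
lemma3p6 w zero    ()
lemma3p6 w (suc m) _  a b A↔ B↔ =
  ↣-×⇒≤-* A↔ B↔ (moveEntry↣ {w = w} zero (fromℕ m) (minIf (w m))
                  (descents-moveFirstToLast {w = w})) ,
  ↣-×⇒≤-* B↔ A↔ (moveEntry↣ {w = shift w} (fromℕ m) zero (maxIf (w 0))
                  (descents-moveLastToFirst {w = w}))
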